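{- For every nonzero rational $u$, let $p = u(u^2+16)$, $q = u^2-20$, $r = u(u^2-20)$, $s = 9u^2$ and $a = \frac{(u^2+4)^2}{9u^4}$. Then $pq(p^2+q^2) = a\,rs(r^2+s^2)$; equivalently $A=p+q$, $B=r-s$, $C=p-q$, $D=r+s$ satisfy $A^4 + aB^4 = C^4 + aD^4$. -}

module Defs where

open import Data.Nat using (ℕ)
open import Data.Integer using (+_)
open import Data.Rational using (ℚ; _+_; _*_; _-_; _/_; 1/_; NonZero)

cst : ℕ → ℚ
cst n = + n / 1

sq : ℚ → ℚ
sq x = x * x

pow4 : ℚ → ℚ
pow4 x = sq (sq x)

pOf qOf rOf sOf : ℚ → ℚ
pOf u = u * (sq u + cst 16)
qOf u = sq u - cst 20
rOf u = u * (sq u - cst 20)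
sOf u = cst 9 * sq u

aOf : (u : ℚ) → .{{NonZero u}} → ℚ
aOf u = sq (sq u + cst 4) * (1/ cst 9) * pow4 (1/ u)

--   * Both sides of the first identity share the polynomial factor
--       K(u) = u(u²-20)((u²-20)² + 81u²):
--     pq(p²+q²) = (u²+4)² K(u)   and   rs(r²+s²) = 9u⁴ K(u).
--   * By definition of a, we have a · 9u⁴ = (u²+4)², so pq(p²+q²) = a·rs(r²+s²).
--   * The quartic form follows from the binomial identity
--       (x+y)⁴ = (x-y)⁴ + 8xy(x²+y²),
--     applied to (p,q) and (r,s): the equation A⁴ + aB⁴ = C⁴ + aD⁴ is
--     exactly 8 times the first identity.
module Submission where

open import Defs
open import Data.Product using (_×_; _,_)
open import Data.Rational using (ℚ; _+_; _*_; _-_; NonZero; 1/_; 1ℚ)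
open import Data.Rational.Properties using (*-inverseˡ)
open import Data.Rational.Solver
open +-*-Solver
open import Relation.Binary.PropositionalEquality
open ≡-Reasoning

fourthPower-sum-diff : (x y : ℚ) →
  pow4 (x + y) ≡ pow4 (x - y) + cst 8 * (x * y * (sq x + sq y))
fourthPower-sum-diff = solve 2 (λ x y →
  let p4 = λ z → (z :* z) :* (z :* z) in
  p4 (x :+ y) := p4 (x :- y) :+ con (cst 8) :* (x :* y :* (x :* x :+ y :* y)))
  refl

quartic-from-crossTerms : (a x y z w : ℚ) →
  x * y * (sq x + sq y) ≡ a * z * w * (sq z + sq w) →
  pow4 (x + y) + a * pow4 (z - w) ≡ pow4 (x - y) + a * pow4 (z + w)
quartic-from-crossTerms a x y z w cross = begin
  pow4 (x + y) + a * pow4 (z - w)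
    ≡⟨ cong (_+ a * pow4 (z - w)) (fourthPower-sum-diff x y) ⟩
  pow4 (x - y) + cst 8 * (x * y * (sq x + sq y)) + a * pow4 (z - w)
    ≡⟨ cong (λ t → pow4 (x - y) + cst 8 * t + a * pow4 (z - w)) cross ⟩
  pow4 (x - y) + cst 8 * (a * z * w * (sq z + sq w)) + a * pow4 (z - w)
    ≡⟨ solve 4 (λ a' c z' w' →
         c :+ con (cst 8) :* (a' :* z' :* w' :* (z' :* z' :+ w' :* w'))
           :+ a' :* ((z' :- w') :* (z' :- w') :* ((z' :- w') :* (z' :- w')))
         := c :+ a' :* ((z' :- w') :* (z' :- w') :* ((z' :- w') :* (z' :- w'))
                        :+ con (cst 8) :* (z' :* w' :* (z' :* z' :+ w' :* w'))))
         refl a (pow4 (x - y)) z w ⟩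
  pow4 (x - y) + a * (pow4 (z - w) + cst 8 * (z * w * (sq z + sq w)))
    ≡⟨ cong (λ t → pow4 (x - y) + a * t) (sym (fourthPower-sum-diff z w)) ⟩
  pow4 (x - y) + a * pow4 (z + w) ∎

commonFactor : ℚ → ℚ
commonFactor u = u * (sq u - cst 20) * (sq (sq u - cst 20) + cst 81 * sq u)

pq-factorisation : (u : ℚ) →
  pOf u * qOf u * (sq (pOf u) + sq (qOf u)) ≡ sq (sq u + cst 4) * commonFactor u
pq-factorisation = solve 1 (λ v →
  let p = v :* (v :* v :+ con (cst 16)) ; q = v :* v :- con (cst 20)
      t = v :* v :- con (cst 20) in
  p :* q :* (p :* p :+ q :* q)
  := ((v :* v :+ con (cst 4)) :* (v :* v :+ con (cst 4))) :*
     (v :* t :* (t :* t :+ con (cst 81) :* (v :* v))))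
  refl

ars-factorisation : (a u : ℚ) →
  a * rOf u * sOf u * (sq (rOf u) + sq (sOf u))
    ≡ a * (cst 9 * pow4 u) * commonFactor u
ars-factorisation = solve 2 (λ a' v →
  let t = v :* v :- con (cst 20) ; r = v :* t ; s = con (cst 9) :* (v :* v) in
  a' :* r :* s :* (r :* r :+ s :* s)
  := a' :* (con (cst 9) :* ((v :* v) :* (v :* v))) :*
     (v :* t :* (t :* t :+ con (cst 81) :* (v :* v))))
  refl

a-times-denominator : (u : ℚ) → .{{_ : NonZero u}} →
  aOf u * (cst 9 * pow4 u) ≡ sq (sq u + cst 4)
a-times-denominator u = begin
  aOf u * (cst 9 * pow4 u)
    ≡⟨ solve 4 (λ n i w v →
         n :* i :* ((w :* w) :* (w :* w)) :* (con (cst 9) :* ((v :* v) :* (v :* v)))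
         := n :* (i :* con (cst 9)) :* ((w :* v) :* (w :* v) :* ((w :* v) :* (w :* v))))
         refl (sq (sq u + cst 4)) (1/ cst 9) (1/ u) u ⟩
  sq (sq u + cst 4) * ((1/ cst 9) * cst 9) * pow4 ((1/ u) * u)
    ≡⟨ cong₂ (λ c d → sq (sq u + cst 4) * c * pow4 d) (*-inverseˡ (cst 9)) (*-inverseˡ u) ⟩
  sq (sq u + cst 4) * 1ℚ * pow4 1ℚ
    ≡⟨ solve 1 (λ n → n :* con 1ℚ :* ((con 1ℚ :* con 1ℚ) :* (con 1ℚ :* con 1ℚ)) := n)
         refl (sq (sq u + cst 4)) ⟩
  sq (sq u + cst 4) ∎

mainTheorem7 : (u : ℚ) → .{{_ : NonZero u}} →
    (pOf u * qOf u * (sq (pOf u) + sq (qOf u))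
       ≡ aOf u * rOf u * sOf u * (sq (rOf u) + sq (sOf u)))
    × (pow4 (pOf u + qOf u) + aOf u * pow4 (rOf u - sOf u)
       ≡ pow4 (pOf u - qOf u) + aOf u * pow4 (rOf u + sOf u))
mainTheorem7 u = crossTerms , quartic-from-crossTerms (aOf u) (pOf u) (qOf u) (rOf u) (sOf u) crossTerms
  where
  crossTerms : pOf u * qOf u * (sq (pOf u) + sq (qOf u))
             ≡ aOf u * rOf u * sOf u * (sq (rOf u) + sq (sOf u))
  crossTerms = begin
    pOf u * qOf u * (sq (pOf u) + sq (qOf u))
      ≡⟨ pq-factorisation u ⟩
    sq (sq u + cst 4) * commonFactor u
      ≡⟨ cong (_* commonFactor u) (sym (a-times-denominator u)) ⟩
    aOf u * (cst 9 * pow4 u) * commonFactor u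
      ≡⟨ sym (ars-factorisation (aOf u) u) ⟩
    aOf u * rOf u * sOf u * (sq (rOf u) + sq (sOf u)) ∎
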